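{- Let $h\colon[n]\to[n]$ be a Hessenberg function and $w\in\mathfrak S_n$ a generator for $h$ with $Y(w)=\{y_0<y_1<\cdots<y_r\}$. Then $w^{ -1}(y_i)\le h(w^{ -1}(y_{i-1}))$ for all $1\le i\le r$.
   Context: A Hessenberg function is a nondecreasing $h\colon[n]\to[n]$ with $h(i)\ge i$. Permutations are in one-line notation. A generator for $h$ is a $w$ with $w^{ -1}(w(i)+1)\le h(i)$ whenever $w(i)\le n-1$. $Y(w)=\{w(i)\mid i\ge w^{ -1}(1),\ w(i)\le w(n)\}$, listed as $y_0<\cdots<y_r$ (so $y_0=1$, $y_r=w(n)$). -}

module Defs where

open import Data.Nat using (ℕ; suc; _<_)
open import Data.Fin using (Fin; zero; fromℕ; fromℕ<; toℕ; _≤_; _≤?_)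
open import Data.Fin.Permutation using (Permutation′; _⟨$⟩ʳ_; _⟨$⟩ˡ_)
open import Data.List using (List; filter; allFin)
open import Data.Product using (_×_)
open import Relation.Nullary.Decidable using (_×-dec_)

-- Convention: [n] = {1,…,n} is modelled by Fin n, with value k ∈ [n]
-- represented by the Fin element with toℕ = k - 1.  We take n = suc m
-- (n ≥ 1) so that the values 1 (= zero) and n (= fromℕ m) exist.

IsHessenberg : ∀ {n} → (Fin n → Fin n) → Set
IsHessenberg h = (∀ i j → i ≤ j → h i ≤ h j) × (∀ i → i ≤ h i)

-- w is a generator for h: whenever w(i) ≤ n-1 (i.e. w(i)+1 is a value in
-- [n]), w⁻¹(w(i)+1) ≤ h(i).
IsGenerator : ∀ {m} → (Fin (suc m) → Fin (suc m)) → Permutation′ (suc m) → Set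
IsGenerator {m} h w =
  ∀ i → (p : suc (toℕ (w ⟨$⟩ʳ i)) < suc m) → (w ⟨$⟩ˡ fromℕ< p) ≤ h i

-- Y(w) = { w(i) | i ≥ w⁻¹(1), w(i) ≤ w(n) }
--      = { v | w⁻¹(v) ≥ w⁻¹(1), v ≤ w(n) },
-- listed in increasing order y₀ < y₁ < … < y_r (filtering allFin keeps
-- the increasing order).
Y : ∀ {m} → Permutation′ (suc m) → List (Fin (suc m))
Y {m} w = filter (λ v → ((w ⟨$⟩ˡ zero) ≤? (w ⟨$⟩ˡ v)) ×-dec (v ≤? (w ⟨$⟩ʳ fromℕ m)))
                 (allFin (suc m))

-- Let a = y_{i-1} < b = y_i and let c = b - 1, so a ≤ c.  Either c = a, or c lies strictly
-- between two consecutive elements of Y(w); then c ∉ Y(w) although c < b ≤ w(n), which forces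
-- w⁻¹(c) < w⁻¹(1) ≤ w⁻¹(a).  In both cases w⁻¹(c) ≤ w⁻¹(a), so the generator condition at
-- w⁻¹(c) and monotonicity of h give w⁻¹(b) ≤ h(w⁻¹(c)) ≤ h(w⁻¹(a)).
module Submission where

open import Defs
open import Data.Nat using (ℕ; suc)
import Data.Nat as ℕ
import Data.Nat.Properties as ℕ
open import Data.Fin using (Fin; zero; suc; toℕ; fromℕ; fromℕ<; inject₁; _≤_; _<_; _≤?_)
open import Data.Fin.Properties using (toℕ-injective; toℕ-fromℕ<; toℕ-inject₁; toℕ<n)
open import Data.Fin.Permutation using (Permutation′; _⟨$⟩ʳ_; _⟨$⟩ˡ_; inverseʳ)
open import Data.List using (length; lookup; allFin)
open import Data.List.Membership.Propositional using (_∉_)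
open import Data.List.Membership.Propositional.Properties using (∈-filter⁺; ∈-filter⁻; ∈-lookup; ∈-allFin)
import Data.List.Relation.Unary.All as All
open import Data.List.Relation.Unary.AllPairs using (AllPairs; _∷_)
import Data.List.Relation.Unary.AllPairs.Properties as AllPairs
open import Data.List.Relation.Unary.Any using (index)
open import Data.List.Relation.Unary.Any.Properties using (lookup-index)
open import Data.Product using (Σ-syntax; _×_; _,_; proj₁; proj₂)
open import Data.Sum using (inj₁; inj₂)
open import Function using (id)
open import Relation.Binary.Core using (Rel)
open import Relation.Binary.Definitions using (Asymmetric; tri<; tri≈; tri>)
open import Relation.Binary.PropositionalEquality using (_≡_; sym; trans; cong; subst)
open import Relation.Nullary using (yes; no; contradiction)
open import Relation.Nullary.Decidable using (_×-dec_)
open import Relation.Unary using (Decidable)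

module _ {a ℓ} {A : Set a} {_≺_ : Rel A ℓ} where

  lookup-strictMono : ∀ {xs} → AllPairs _≺_ xs →
    ∀ {i j : Fin (length xs)} → toℕ i ℕ.< toℕ j → lookup xs i ≺ lookup xs j
  lookup-strictMono (x≺xs ∷ _)  {zero}  {suc j} _         = All.lookup x≺xs (∈-lookup j)
  lookup-strictMono (_ ∷ xs↗) {suc i} {suc j} (ℕ.s≤s i<j) = lookup-strictMono xs↗ i<j

  lookup-reflects-≺ : Asymmetric _≺_ → ∀ {xs} → AllPairs _≺_ xs →
    ∀ {i j : Fin (length xs)} → lookup xs i ≺ lookup xs j → toℕ i ℕ.< toℕ j
  lookup-reflects-≺ asym xs↗ {i} {j} xᵢ≺xⱼ with ℕ.<-cmp (toℕ i) (toℕ j)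
  ... | tri< i<j _ _ = i<j
  ... | tri≈ _ i≡j _ rewrite toℕ-injective i≡j = contradiction xᵢ≺xⱼ (asym xᵢ≺xⱼ)
  ... | tri> _ _ j<i = contradiction (lookup-strictMono xs↗ j<i) (asym xᵢ≺xⱼ)

  ∉-between-consecutive : Asymmetric _≺_ → ∀ {xs x} → AllPairs _≺_ xs →
    ∀ {k k′ : Fin (length xs)} → toℕ k′ ≡ suc (toℕ k) →
    lookup xs k ≺ x → x ≺ lookup xs k′ → x ∉ xs
  ∉-between-consecutive asym {xs} xs↗ {k} {k′} k′≡1+k xₖ≺x x≺xₖ′ x∈xs =
    ℕ.<⇒≱ k<j (ℕ.s≤s⁻¹ (subst (toℕ j ℕ.<_) k′≡1+k j<k′))
    where
    j : Fin (length xs)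
    j = index x∈xs
    k<j : toℕ k ℕ.< toℕ j
    k<j = lookup-reflects-≺ asym xs↗ (subst (lookup xs k ≺_) (lookup-index x∈xs) xₖ≺x)
    j<k′ : toℕ j ℕ.< toℕ k′
    j<k′ = lookup-reflects-≺ asym xs↗ (subst (_≺ lookup xs k′) (lookup-index x∈xs) x≺xₖ′)

module _ {m : ℕ} (w : Permutation′ (suc m)) where

  private
    InY : Fin (suc m) → Set
    InY v = ((w ⟨$⟩ˡ zero) ≤ (w ⟨$⟩ˡ v)) × (v ≤ (w ⟨$⟩ʳ fromℕ m))

    InY? : Decidable InY
    InY? v = ((w ⟨$⟩ˡ zero) ≤? (w ⟨$⟩ˡ v)) ×-dec (v ≤? (w ⟨$⟩ʳ fromℕ m))

  Y-strictlyIncreasing : AllPairs _<_ (Y w)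
  Y-strictlyIncreasing = AllPairs.filter⁺ InY? (AllPairs.tabulate⁺-< id)

  lookup-Y : ∀ k → InY (lookup (Y w) k)
  lookup-Y k = proj₂ (∈-filter⁻ InY? {xs = allFin (suc m)} (∈-lookup k))

  ∉Y⇒w⁻¹<w⁻¹zero : ∀ {c} → c ≤ (w ⟨$⟩ʳ fromℕ m) → c ∉ Y w → (w ⟨$⟩ˡ c) < (w ⟨$⟩ˡ zero)
  ∉Y⇒w⁻¹<w⁻¹zero {c} c≤wn c∉Y with (w ⟨$⟩ˡ zero) ≤? (w ⟨$⟩ˡ c)
  ... | yes w⁻¹zero≤w⁻¹c = contradiction (∈-filter⁺ InY? (∈-allFin c) (w⁻¹zero≤w⁻¹c , c≤wn)) c∉Y
  ... | no  w⁻¹zero≰w⁻¹c = ℕ.≰⇒> w⁻¹zero≰w⁻¹c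

  y≤c<y′⇒w⁻¹c≤w⁻¹y : ∀ {k k′} → toℕ k′ ≡ suc (toℕ k) → ∀ {c} →
    lookup (Y w) k ≤ c → c < lookup (Y w) k′ → (w ⟨$⟩ˡ c) ≤ (w ⟨$⟩ˡ lookup (Y w) k)
  y≤c<y′⇒w⁻¹c≤w⁻¹y {k} {k′} k′≡1+k {c} y≤c c<y′ with ℕ.m≤n⇒m<n∨m≡n y≤c
  ... | inj₂ y≡c = subst (λ v → (w ⟨$⟩ˡ c) ≤ (w ⟨$⟩ˡ v)) (toℕ-injective (sym y≡c)) ℕ.≤-refl
  ... | inj₁ y<c = ℕ.<⇒≤ (ℕ.<-≤-trans (∉Y⇒w⁻¹<w⁻¹zero c≤wn c∉Y) (proj₁ (lookup-Y k)))
    where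
    c≤wn : c ≤ (w ⟨$⟩ʳ fromℕ m)
    c≤wn = ℕ.<⇒≤ (ℕ.<-≤-trans c<y′ (proj₂ (lookup-Y k′)))
    c∉Y : c ∉ Y w
    c∉Y = ∉-between-consecutive ℕ.<-asym Y-strictlyIncreasing k′≡1+k y<c c<y′

generator-step : ∀ {m} {h : Fin (suc m) → Fin (suc m)} {w : Permutation′ (suc m)} →
  IsGenerator h w → ∀ {c b} → toℕ b ≡ suc (toℕ c) → (w ⟨$⟩ˡ b) ≤ h (w ⟨$⟩ˡ c)
generator-step {m} {h} {w} gen {c} {b} b≡1+c =
  subst (λ v → (w ⟨$⟩ˡ v) ≤ h (w ⟨$⟩ˡ c)) (toℕ-injective (trans (toℕ-fromℕ< 1+w[i]<n) w[i]+1≡b))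
        (gen (w ⟨$⟩ˡ c) 1+w[i]<n)
  where
  w[i]+1≡b : suc (toℕ (w ⟨$⟩ʳ (w ⟨$⟩ˡ c))) ≡ toℕ b
  w[i]+1≡b = trans (cong (λ v → suc (toℕ v)) (inverseʳ w)) (sym b≡1+c)
  1+w[i]<n : suc (toℕ (w ⟨$⟩ʳ (w ⟨$⟩ˡ c))) ℕ.< suc m
  1+w[i]<n = subst (ℕ._< suc m) (sym w[i]+1≡b) (toℕ<n b)

predecessor : ∀ {n} {a b : Fin (suc n)} → a < b → Σ[ c ∈ Fin (suc n) ] toℕ b ≡ suc (toℕ c)
predecessor {b = zero}   ()
predecessor {b = suc b′} _  = inject₁ b′ , cong suc (sym (toℕ-inject₁ b′))

lemma4p1 : (m : ℕ) (h : Fin (suc m) → Fin (suc m)) (w : Permutation′ (suc m)) →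
    IsHessenberg h → IsGenerator h w →
    (k k′ : Fin (length (Y w))) → toℕ k′ ≡ suc (toℕ k) →
    (w ⟨$⟩ˡ lookup (Y w) k′) ≤ h (w ⟨$⟩ˡ lookup (Y w) k)
lemma4p1 m h w (h-mono , _) gen k k′ k′≡1+k =
  ℕ.≤-trans (generator-step {w = w} gen b≡1+c) (h-mono (w ⟨$⟩ˡ c) (w ⟨$⟩ˡ a) w⁻¹c≤w⁻¹a)
  where
  a b : Fin (suc m)
  a = lookup (Y w) k
  b = lookup (Y w) k′
  a<b : a < b
  a<b = lookup-strictMono (Y-strictlyIncreasing w) (subst (toℕ k ℕ.<_) (sym k′≡1+k) (ℕ.n<1+n (toℕ k)))
  c : Fin (suc m)
  c = proj₁ (predecessor a<b)
  b≡1+c : toℕ b ≡ suc (toℕ c)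
  b≡1+c = proj₂ (predecessor a<b)
  w⁻¹c≤w⁻¹a : (w ⟨$⟩ˡ c) ≤ (w ⟨$⟩ˡ a)
  w⁻¹c≤w⁻¹a = y≤c<y′⇒w⁻¹c≤w⁻¹y w k′≡1+k
    (ℕ.s≤s⁻¹ (subst (suc (toℕ a) ℕ.≤_) b≡1+c a<b))
    (subst (toℕ c ℕ.<_) (sym b≡1+c) (ℕ.n<1+n (toℕ c)))
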